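{- Let $d,j,k$ be non-negative integers such that $d>1$. Then $T_d(j,k)={{j+k}\choose{k}}$.
   Context: A word is a finite word over $\{0,1\}$; $w_i$ is its $i$-th letter. A word is flat if it contains at least as many zeros as ones; it is a Dyck word if its first $k$ letters form a flat word for every $k$. For an integer $d>1$, a Dyck word $w$ of length $kd$ is $d$-rigid if: (i) for each $0\le t<k$ the subword $w_{td+1}\cdots w_{td+d}$ either consists of $d$ ones, or consists of $d$ zeros, or contains precisely $d-1$ zeros (then it is called a rigid-type-2 interval), or contains precisely $d-1$ ones (then it is called a rigid-type-3 interval); and (ii) the letters preceding any rigid-type-2 interval contain the same number of zeros as ones, and the letters from the beginning of $w$ through the end of any rigid-type-3 interval contain the same number of zeros as ones. A $d$-straightened Dyck word is a $d$-rigid Dyck word all of whose rigid-type-2 intervals end in a one and all of whose rigid-type-3 intervals begin with a zero. For non-negative integers $j,k$: if $j\ge k$, $T_d(j,k)$ is the number of $d$-straightened Dyck words containing $dj$ zeros and $dk$ ones; if $j<k$, $T_d(j,k)$ is the number of $d$-straightened Dyck words containing $dk-1$ zeros and $dj+1$ ones. -}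

module Defs where

open import Data.Nat using (ℕ; zero; suc; _+_; _*_; _∸_; _≤_; _≤?_)
open import Data.Nat.Properties using (_≟_)
open import Data.List using (List; []; _∷_; length; take; drop; inits; upTo; filter; head; last; concatMap)
open import Data.List.Relation.Unary.All using (All; all?)
open import Data.Maybe using (Maybe; just)
import Data.Maybe.Properties as MaybeP
open import Data.Product using (_×_)
open import Data.Sum using (_⊎_)
open import Relation.Nullary using (Dec; yes; no; ¬_)
open import Relation.Nullary.Decidable using (_×-dec_; _⊎-dec_; _→-dec_)
open import Relation.Binary.PropositionalEquality using (_≡_; refl)
open import Relation.Binary.Definitions using (DecidableEquality)

data Letter : Set where
  𝟎 𝟏 : Letter

_≟L_ : DecidableEquality Letter
𝟎 ≟L 𝟎 = yes refl
𝟎 ≟L 𝟏 = no λ ()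
𝟏 ≟L 𝟎 = no λ ()
𝟏 ≟L 𝟏 = yes refl

Word : Set
Word = List Letter

occ : Letter → Word → ℕ
occ a [] = 0
occ a (b ∷ w) with a ≟L b
... | yes _ = suc (occ a w)
... | no  _ = occ a w

zeros ones : Word → ℕ
zeros = occ 𝟎
ones  = occ 𝟏

Flat : Word → Set
Flat w = ones w ≤ zeros w

Dyck : Word → Set
Dyck w = All Flat (inits w)

Balanced : Word → Set
Balanced w = zeros w ≡ ones w

-- For a word of length k*d: the t-th block w_{td+1}..w_{td+d} (t = 0..k-1),
-- the letters preceding it, and the letters through its end.
block before throughEnd : ℕ → ℕ → Word → Word
block d t w = take d (drop (t * d) w)
before d t w = take (t * d) w
throughEnd d t w = take (t * d + d) w

BlockShape : ℕ → ℕ → Word → Set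
BlockShape d t w =
  (ones (block d t w) ≡ d) ⊎ (zeros (block d t w) ≡ d)
  ⊎ (zeros (block d t w) ≡ d ∸ 1) ⊎ (ones (block d t w) ≡ d ∸ 1)

Type2 Type3 : ℕ → ℕ → Word → Set
Type2 d t w = zeros (block d t w) ≡ d ∸ 1
Type3 d t w = ones (block d t w) ≡ d ∸ 1

BlockCond : ℕ → ℕ → Word → Set
BlockCond d t w =
  (Type2 d t w → Balanced (before d t w)) × (Type3 d t w → Balanced (throughEnd d t w))

BlockStraight : ℕ → ℕ → Word → Set
BlockStraight d t w =
  (Type2 d t w → last (block d t w) ≡ just 𝟏) × (Type3 d t w → head (block d t w) ≡ just 𝟎)

Rigid : ℕ → ℕ → Word → Set
Rigid d k w = (length w ≡ k * d) × Dyck w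
  × All (λ t → BlockShape d t w × BlockCond d t w) (upTo k)

Straightened : ℕ → ℕ → Word → Set
Straightened d k w = Rigid d k w × All (λ t → BlockStraight d t w) (upTo k)

flat? : (w : Word) → Dec (Flat w)
flat? w = ones w ≤? zeros w

dyck? : (w : Word) → Dec (Dyck w)
dyck? w = all? flat? (inits w)

balanced? : (w : Word) → Dec (Balanced w)
balanced? w = zeros w ≟ ones w

maybe≟ : DecidableEquality (Maybe Letter)
maybe≟ = MaybeP.≡-dec _≟L_

rigid? : (d k : ℕ) → (w : Word) → Dec (Rigid d k w)
rigid? d k w = (length w ≟ k * d) ×-dec dyck? w ×-dec all? blk (upTo k)
  where
  blk : (t : ℕ) → Dec (BlockShape d t w × BlockCond d t w)
  blk t = ((ones b ≟ d) ⊎-dec (zeros b ≟ d) ⊎-dec (zeros b ≟ d ∸ 1) ⊎-dec (ones b ≟ d ∸ 1))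
          ×-dec (((zeros b ≟ d ∸ 1) →-dec balanced? (before d t w))
                 ×-dec ((ones b ≟ d ∸ 1) →-dec balanced? (throughEnd d t w)))
    where b = block d t w

straightened? : (d k : ℕ) → (w : Word) → Dec (Straightened d k w)
straightened? d k w = rigid? d k w ×-dec all? str (upTo k)
  where
  str : (t : ℕ) → Dec (BlockStraight d t w)
  str t = ((zeros (block d t w) ≟ d ∸ 1) →-dec maybe≟ (last (block d t w)) (just 𝟏))
          ×-dec ((ones (block d t w) ≟ d ∸ 1) →-dec maybe≟ (head (block d t w)) (just 𝟎))

allWords : ℕ → List Word
allWords zero = [] ∷ []
allWords (suc n) = concatMap (λ w → (𝟎 ∷ w) ∷ (𝟏 ∷ w) ∷ []) (allWords n)

countStraight : (d m z o : ℕ) → ℕ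
countStraight d m z o =
  length (filter (λ w → straightened? d m w ×-dec (zeros w ≟ z) ×-dec (ones w ≟ o))
                 (allWords (d * m)))

T : ℕ → ℕ → ℕ → ℕ
T d j k with k ≤? j
... | yes _ = countStraight d (j + k) (d * j) (d * k)
... | no  _ = countStraight d (j + k) (d * k ∸ 1) (d * j + 1)

module Submission where

-- T_d(j,k) = C(j+k, k) for d > 1.  Read a word as a walk on heights
-- (#zeros - #ones).  In a d-straightened Dyck word a block of length d can
-- follow a prefix of height g in only four ways: 0^d (g ↦ g+d), 1^d (g ↦ g-d,
-- needs g ≥ d), 0^(d-1)1 (0 ↦ d-2) and 01^(d-1) (d-2 ↦ 0).  Give heights an
-- integer state: n ≥ 0 sits at height n·d and -(n+1) at height n·d + d-2.
-- Every state is then entered in exactly two ways, from its two integer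
-- neighbours, so the number of words of m blocks ending in state u - v obeys
-- Pascal's rule and equals C(u+v, v) when m = u + v.

open import Defs
open import Data.Nat using (ℕ; zero; suc; _+_; _*_; _∸_; _≤_; _<_; _≤?_; z≤n; s≤s; s≤s⁻¹; z<s)
open import Data.Nat.Properties
open import Data.Nat.Combinatorics using (_C_; nCn≡1; nCk+nC[k+1]≡[n+1]C[k+1])
open import Data.Nat.ListAction using (sum)
open import Data.Nat.ListAction.Properties using (sum-++)
open import Data.Nat.Tactic.RingSolver using (solve-∀)
open import Data.List using (List; []; _∷_; _++_; length; take; drop; inits; filter; map; concatMap; head; last; replicate)
open import Data.List.Properties using (map-++; map-cong; length-++; length-replicate; take-all; ∷-injective)
import Data.List.Properties as List
import Data.List.Relation.Unary.All as All
open import Data.List.Relation.Unary.All using (All; []; _∷_)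
import Data.List.Relation.Unary.All.Properties as All
open import Data.Maybe using (Maybe; just; nothing)
import Data.Maybe.Properties as Maybe
open import Data.Product using (Σ-syntax; _×_; _,_; proj₁; proj₂)
open import Data.Sum using (_⊎_; inj₁; inj₂)
import Data.Sum as Sum
open import Function using (_∘_; id)
open import Function.Bundles using (_⇔_; mk⇔; Equivalence)
open import Relation.Nullary using (Dec; yes; no; ¬_; contradiction)
open import Relation.Nullary.Decidable using (_×-dec_; _⊎-dec_)
open import Relation.Unary using (Decidable)
open import Relation.Binary.PropositionalEquality
open import Relation.Binary.Definitions using (tri<; tri≈; tri>)
open import Algebra.Properties.CommutativeSemigroup +-commutativeSemigroup using (interchange)

open Equivalence using (to; from)
open ≡-Reasoning

private
  variable
    P Q P′ Q′ : Set

𝟙 : Dec P → ℕ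
𝟙 (yes _) = 1
𝟙 (no _)  = 0

𝟙-cong : P ⇔ Q → (p : Dec P) (q : Dec Q) → 𝟙 p ≡ 𝟙 q
𝟙-cong P⇔Q (yes _)  (yes _)  = refl
𝟙-cong P⇔Q (yes p)  (no ¬q)  = contradiction (to P⇔Q p) ¬q
𝟙-cong P⇔Q (no ¬p)  (yes q)  = contradiction (from P⇔Q q) ¬p
𝟙-cong P⇔Q (no _)   (no _)   = refl

𝟙-no : ¬ P → (p : Dec P) → 𝟙 p ≡ 0
𝟙-no ¬p (yes p) = contradiction p ¬p
𝟙-no ¬p (no _)  = refl

𝟙-× : (p : Dec P) (q : Dec Q) → 𝟙 (p ×-dec q) ≡ 𝟙 p * 𝟙 q
𝟙-× (yes _) (yes _) = refl
𝟙-× (yes _) (no _)  = refl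
𝟙-× (no _)  (yes _) = refl
𝟙-× (no _)  (no _)  = refl

𝟙-⊎ : ¬ (P × Q) → (p : Dec P) (q : Dec Q) → 𝟙 (p ⊎-dec q) ≡ 𝟙 p + 𝟙 q
𝟙-⊎ exclusive (yes p) (yes q) = contradiction (p , q) exclusive
𝟙-⊎ exclusive (yes _) (no _)  = refl
𝟙-⊎ exclusive (no _)  (yes _) = refl
𝟙-⊎ exclusive (no _)  (no _)  = refl

module _ {A : Set} where

  length-filter≡sum : {R : A → Set} (R? : Decidable R) (xs : List A) →
                      length (filter R? xs) ≡ sum (map (𝟙 ∘ R?) xs)
  length-filter≡sum R? [] = refl
  length-filter≡sum R? (x ∷ xs) with R? x
  ... | yes _ = cong suc (length-filter≡sum R? xs)
  ... | no _  = length-filter≡sum R? xs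

  sum-map-concatMap : {B : Set} (f : B → ℕ) (g : A → List B) (xs : List A) →
                      sum (map f (concatMap g xs)) ≡ sum (map (λ x → sum (map f (g x))) xs)
  sum-map-concatMap f g [] = refl
  sum-map-concatMap f g (x ∷ xs) = begin
    sum (map f (g x ++ concatMap g xs))                ≡⟨ cong sum (map-++ f (g x) (concatMap g xs)) ⟩
    sum (map f (g x) ++ map f (concatMap g xs))        ≡⟨ sum-++ (map f (g x)) _ ⟩
    sum (map f (g x)) + sum (map f (concatMap g xs))   ≡⟨ cong (sum (map f (g x)) +_) (sum-map-concatMap f g xs) ⟩
    sum (map f (g x)) + sum (map (λ x → sum (map f (g x))) xs) ∎

  sum-map-+ : (f g : A → ℕ) (xs : List A) →
              sum (map (λ x → f x + g x) xs) ≡ sum (map f xs) + sum (map g xs)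
  sum-map-+ f g [] = refl
  sum-map-+ f g (x ∷ xs) = trans (cong (f x + g x +_) (sum-map-+ f g xs))
                                 (interchange (f x) (g x) (sum (map f xs)) (sum (map g xs)))

  sum-map-*ʳ : (f : A → ℕ) (c : ℕ) (xs : List A) →
               sum (map (λ x → f x * c) xs) ≡ sum (map f xs) * c
  sum-map-*ʳ f c [] = refl
  sum-map-*ʳ f c (x ∷ xs) = trans (cong (f x * c +_) (sum-map-*ʳ f c xs))
                                  (sym (*-distribʳ-+ c (f x) (sum (map f xs))))

  sum-map-zero : (xs : List A) → sum (map (λ _ → 0) xs) ≡ 0
  sum-map-zero [] = refl
  sum-map-zero (x ∷ xs) = sum-map-zero xs

difference-and-sum : ∀ {x y z o h} → x ≡ y + h → z ≡ o + h → x + y ≡ z + o → x ≡ z × y ≡ o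
difference-and-sum {y = y} {o = o} {h = h} x≡ z≡ sum≡ with <-cmp y o
... | tri< y<o _ _ = contradiction sum≡ (<⇒≢ (+-mono-< (subst₂ _<_ (sym x≡) (sym z≡) (+-monoˡ-< h y<o)) y<o))
... | tri≈ _ y≡o _ = trans x≡ (trans (cong (_+ h) y≡o) (sym z≡)) , y≡o
... | tri> _ _ o<y = contradiction (sym sum≡) (<⇒≢ (+-mono-< (subst₂ _<_ (sym z≡) (sym x≡) (+-monoˡ-< h o<y)) o<y))

_≟W_ : (u v : Word) → Dec (u ≡ v)
_≟W_ = List.≡-dec _≟L_

total : ℕ → (Word → ℕ) → ℕ
total n f = sum (map f (allWords n))

total-suc : ∀ n f → total (suc n) f ≡ total n (λ w → f (𝟎 ∷ w) + f (𝟏 ∷ w))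
total-suc n f = trans (sum-map-concatMap f (λ w → (𝟎 ∷ w) ∷ (𝟏 ∷ w) ∷ []) (allWords n))
                      (cong sum (map-cong (λ w → cong (f (𝟎 ∷ w) +_) (+-identityʳ _)) (allWords n)))

total-cong : ∀ n f g → (∀ w → length w ≡ n → f w ≡ g w) → total n f ≡ total n g
total-cong zero f g f≗g = cong (_+ 0) (f≗g [] refl)
total-cong (suc n) f g f≗g = begin
  total (suc n) f                            ≡⟨ total-suc n f ⟩
  total n (λ w → f (𝟎 ∷ w) + f (𝟏 ∷ w))      ≡⟨ total-cong n _ _ (λ w len →
                                                  cong₂ _+_ (f≗g (𝟎 ∷ w) (cong suc len)) (f≗g (𝟏 ∷ w) (cong suc len))) ⟩
  total n (λ w → g (𝟎 ∷ w) + g (𝟏 ∷ w))      ≡⟨ total-suc n g ⟨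
  total (suc n) g                            ∎

total-+ : ∀ n f g → total n (λ w → f w + g w) ≡ total n f + total n g
total-+ n f g = sum-map-+ f g (allWords n)

total-++ : ∀ k n f → total (k + n) f ≡ total k (λ r → total n (λ u → f (r ++ u)))
total-++ zero n f = sym (+-identityʳ _)
total-++ (suc k) n f = begin
  total (suc (k + n)) f                                                     ≡⟨ total-suc (k + n) f ⟩
  total (k + n) (λ w → f (𝟎 ∷ w) + f (𝟏 ∷ w))                              ≡⟨ total-++ k n _ ⟩
  total k (λ r → total n (λ u → f (𝟎 ∷ r ++ u) + f (𝟏 ∷ r ++ u)))          ≡⟨ total-cong k _ _ (λ r _ → total-+ n _ _) ⟩
  total k (λ r → total n (λ u → f (𝟎 ∷ r ++ u)) + total n (λ u → f (𝟏 ∷ r ++ u))) ≡⟨ total-suc k _ ⟨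
  total (suc k) (λ r → total n (λ u → f (r ++ u)))                          ∎

letter-once : ∀ x → 𝟙 (𝟎 ≟L x) + 𝟙 (𝟏 ≟L x) ≡ 1
letter-once 𝟎 = refl
letter-once 𝟏 = refl

total-point : ∀ n b → length b ≡ n → total n (λ w → 𝟙 (w ≟W b)) ≡ 1
total-point zero [] refl = refl
total-point (suc n) (x ∷ b) len = begin
  total (suc n) (λ w → 𝟙 (w ≟W (x ∷ b)))                         ≡⟨ total-suc n _ ⟩
  total n (λ w → 𝟙 ((𝟎 ∷ w) ≟W (x ∷ b)) + 𝟙 ((𝟏 ∷ w) ≟W (x ∷ b))) ≡⟨ total-cong n _ _ (λ w _ → first-letter w) ⟩
  total n (λ w → 𝟙 (w ≟W b))                                      ≡⟨ total-point n b (suc-injective len) ⟩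
  1                                                               ∎
  where
  cons-𝟙 : ∀ y w → 𝟙 ((y ∷ w) ≟W (x ∷ b)) ≡ 𝟙 (y ≟L x) * 𝟙 (w ≟W b)
  cons-𝟙 y w = trans (𝟙-cong (mk⇔ ∷-injective (λ (p , q) → cong₂ _∷_ p q)) ((y ∷ w) ≟W (x ∷ b)) (y ≟L x ×-dec w ≟W b))
                     (𝟙-× (y ≟L x) (w ≟W b))
  first-letter : ∀ w → 𝟙 ((𝟎 ∷ w) ≟W (x ∷ b)) + 𝟙 ((𝟏 ∷ w) ≟W (x ∷ b)) ≡ 𝟙 (w ≟W b)
  first-letter w = begin
    𝟙 ((𝟎 ∷ w) ≟W (x ∷ b)) + 𝟙 ((𝟏 ∷ w) ≟W (x ∷ b)) ≡⟨ cong₂ _+_ (cons-𝟙 𝟎 w) (cons-𝟙 𝟏 w) ⟩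
    𝟙 (𝟎 ≟L x) * 𝟙 (w ≟W b) + 𝟙 (𝟏 ≟L x) * 𝟙 (w ≟W b) ≡⟨ *-distribʳ-+ (𝟙 (w ≟W b)) (𝟙 (𝟎 ≟L x)) (𝟙 (𝟏 ≟L x)) ⟨
    (𝟙 (𝟎 ≟L x) + 𝟙 (𝟏 ≟L x)) * 𝟙 (w ≟W b)            ≡⟨ cong (_* 𝟙 (w ≟W b)) (letter-once x) ⟩
    1 * 𝟙 (w ≟W b)                                   ≡⟨ *-identityˡ _ ⟩
    𝟙 (w ≟W b)                                       ∎

count-two : ∀ n {R : Word → Set} (R? : Decidable R) {A B : Set} (A? : Dec A) (B? : Dec B) {b₁ b₂ : Word} →
            b₁ ≢ b₂ → length b₁ ≡ n → length b₂ ≡ n →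
            (∀ u → length u ≡ n → R u ⇔ ((u ≡ b₁ × A) ⊎ (u ≡ b₂ × B))) →
            total n (𝟙 ∘ R?) ≡ 𝟙 A? + 𝟙 B?
count-two n R? A? B? {b₁} {b₂} b₁≢b₂ len₁ len₂ R⇔ = begin
  total n (𝟙 ∘ R?)                                                   ≡⟨ total-cong n _ _ indicator ⟩
  total n (λ u → 𝟙 (u ≟W b₁) * 𝟙 A? + 𝟙 (u ≟W b₂) * 𝟙 B?)           ≡⟨ total-+ n (λ u → 𝟙 (u ≟W b₁) * 𝟙 A?) (λ u → 𝟙 (u ≟W b₂) * 𝟙 B?) ⟩
  total n (λ u → 𝟙 (u ≟W b₁) * 𝟙 A?) + total n (λ u → 𝟙 (u ≟W b₂) * 𝟙 B?)
    ≡⟨ cong₂ _+_ (sum-map-*ʳ (λ u → 𝟙 (u ≟W b₁)) (𝟙 A?) (allWords n))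
                 (sum-map-*ʳ (λ u → 𝟙 (u ≟W b₂)) (𝟙 B?) (allWords n)) ⟩
  total n (λ u → 𝟙 (u ≟W b₁)) * 𝟙 A? + total n (λ u → 𝟙 (u ≟W b₂)) * 𝟙 B?
    ≡⟨ cong₂ _+_ (cong (_* 𝟙 A?) (total-point n b₁ len₁)) (cong (_* 𝟙 B?) (total-point n b₂ len₂)) ⟩
  1 * 𝟙 A? + 1 * 𝟙 B?                                                ≡⟨ cong₂ _+_ (*-identityˡ (𝟙 A?)) (*-identityˡ (𝟙 B?)) ⟩
  𝟙 A? + 𝟙 B?                                                        ∎
  where
  indicator : ∀ u → length u ≡ n → 𝟙 (R? u) ≡ 𝟙 (u ≟W b₁) * 𝟙 A? + 𝟙 (u ≟W b₂) * 𝟙 B?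
  indicator u len = begin
    𝟙 (R? u)                                             ≡⟨ 𝟙-cong (R⇔ u len) _ ((u ≟W b₁ ×-dec A?) ⊎-dec (u ≟W b₂ ×-dec B?)) ⟩
    𝟙 ((u ≟W b₁ ×-dec A?) ⊎-dec (u ≟W b₂ ×-dec B?))      ≡⟨ 𝟙-⊎ (λ ((u≡b₁ , _) , (u≡b₂ , _)) → b₁≢b₂ (trans (sym u≡b₁) u≡b₂))
                                                                (u ≟W b₁ ×-dec A?) (u ≟W b₂ ×-dec B?) ⟩
    𝟙 (u ≟W b₁ ×-dec A?) + 𝟙 (u ≟W b₂ ×-dec B?)          ≡⟨ cong₂ _+_ (𝟙-× (u ≟W b₁) A?) (𝟙-× (u ≟W b₂) B?) ⟩
    𝟙 (u ≟W b₁) * 𝟙 A? + 𝟙 (u ≟W b₂) * 𝟙 B?              ∎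

occ-++ : ∀ a r u → occ a (r ++ u) ≡ occ a r + occ a u
occ-++ a [] u = refl
occ-++ a (b ∷ r) u with a ≟L b
... | yes _ = cong suc (occ-++ a r u)
... | no _  = occ-++ a r u

occ-replicate : ∀ a n → occ a (replicate n a) ≡ n
occ-replicate a zero = refl
occ-replicate a (suc n) with a ≟L a
... | yes _ = cong suc (occ-replicate a n)
... | no a≢a = contradiction refl a≢a

occ-replicate-other : ∀ a b → a ≢ b → ∀ n → occ a (replicate n b) ≡ 0
occ-replicate-other a b a≢b zero = refl
occ-replicate-other a b a≢b (suc n) with a ≟L b
... | yes a≡b = contradiction a≡b a≢b
... | no _    = occ-replicate-other a b a≢b n

zeros+ones : ∀ w → zeros w + ones w ≡ length w
zeros+ones [] = refl
zeros+ones (𝟎 ∷ w) = cong suc (zeros+ones w)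
zeros+ones (𝟏 ∷ w) = trans (+-suc (zeros w) (ones w)) (cong suc (zeros+ones w))

no-zeros : ∀ w → zeros w ≡ 0 → w ≡ replicate (length w) 𝟏
no-zeros [] _ = refl
no-zeros (𝟏 ∷ w) z≡0 = cong (𝟏 ∷_) (no-zeros w z≡0)

no-ones : ∀ w → ones w ≡ 0 → w ≡ replicate (length w) 𝟎
no-ones [] _ = refl
no-ones (𝟎 ∷ w) o≡0 = cong (𝟎 ∷_) (no-ones w o≡0)

no-ones-last : ∀ w → ones w ≡ 0 → last w ≢ just 𝟏
no-ones-last (𝟎 ∷ []) _ ()
no-ones-last (𝟎 ∷ x ∷ w) o≡0 = no-ones-last (x ∷ w) o≡0

single-final-one : ∀ w → ones w ≡ 1 → last w ≡ just 𝟏 → w ≡ replicate (zeros w) 𝟎 ++ 𝟏 ∷ []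
single-final-one (𝟎 ∷ []) () _
single-final-one (𝟎 ∷ x ∷ w) o≡1 l≡1 = cong (𝟎 ∷_) (single-final-one (x ∷ w) o≡1 l≡1)
single-final-one (𝟏 ∷ []) _ _ = refl
single-final-one (𝟏 ∷ x ∷ w) o≡1 l≡1 = contradiction l≡1 (no-ones-last (x ∷ w) (suc-injective o≡1))

last-snoc : ∀ (w : Word) x → last (w ++ x ∷ []) ≡ just x
last-snoc [] x = refl
last-snoc (y ∷ []) x = refl
last-snoc (y ∷ z ∷ w) x = last-snoc (z ∷ w) x

last-replicate : ∀ (x y : Letter) n → last (x ∷ replicate (suc n) y) ≡ just y
last-replicate x y zero = refl
last-replicate x y (suc n) = last-replicate y y n

walk : ℕ → Word → Maybe ℕ
walk h [] = just h
walk h (𝟎 ∷ w) = walk (suc h) w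
walk zero (𝟏 ∷ w) = nothing
walk (suc h) (𝟏 ∷ w) = walk h w

walk-++ : ∀ h r u {H} → walk h (r ++ u) ≡ just H ⇔ (Σ[ g ∈ ℕ ] (walk h r ≡ just g × walk g u ≡ just H))
walk-++ h [] u = mk⇔ (λ walkH → h , refl , walkH) (λ { (_ , refl , walkH) → walkH })
walk-++ h (𝟎 ∷ r) u = walk-++ (suc h) r u
walk-++ zero (𝟏 ∷ r) u = mk⇔ (λ ()) (λ { (_ , () , _) })
walk-++ (suc h) (𝟏 ∷ r) u = walk-++ h r u

walk-counts : ∀ {h g} w → walk h w ≡ just g → h + zeros w ≡ ones w + g
walk-counts {h} [] refl = +-identityʳ h
walk-counts {h} (𝟎 ∷ w) walkg = trans (+-suc h (zeros w)) (walk-counts w walkg)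
walk-counts {suc h} (𝟏 ∷ w) walkg = cong suc (walk-counts w walkg)

walk-zeros : ∀ n h → walk h (replicate n 𝟎) ≡ just (n + h)
walk-zeros zero h = refl
walk-zeros (suc n) h = trans (walk-zeros n (suc h)) (cong just (+-suc n h))

walk-ones : ∀ n h → walk (n + h) (replicate n 𝟏) ≡ just h
walk-ones zero h = refl
walk-ones (suc n) h = walk-ones n h

FlatFrom : ℕ → Word → Set
FlatFrom h v = ones v ≤ h + zeros v

flat-prefixes⇔walk : ∀ h w → All (FlatFrom h) (inits w) ⇔ (Σ[ g ∈ ℕ ] walk h w ≡ just g)
flat-prefixes⇔walk h [] = mk⇔ (λ _ → h , refl) (λ _ → z≤n ∷ [])
flat-prefixes⇔walk h (𝟎 ∷ w) = mk⇔
  (λ { (_ ∷ flats) → to (flat-prefixes⇔walk (suc h) w)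
                      (All.map (λ {v} → subst (ones v ≤_) (+-suc h (zeros v))) (All.map⁻ flats)) })
  (λ walks → z≤n ∷ All.map⁺ (All.map (λ {v} → subst (ones v ≤_) (sym (+-suc h (zeros v))))
                                     (from (flat-prefixes⇔walk (suc h) w) walks)))
flat-prefixes⇔walk zero (𝟏 ∷ w) = mk⇔ (λ { (_ ∷ () ∷ _) }) (λ { (_ , ()) })
flat-prefixes⇔walk (suc h) (𝟏 ∷ w) = mk⇔
  (λ { (_ ∷ flats) → to (flat-prefixes⇔walk h w) (All.map s≤s⁻¹ (All.map⁻ flats)) })
  (λ walks → z≤n ∷ All.map⁺ (All.map s≤s (from (flat-prefixes⇔walk h w) walks)))

dyck⇔walk : ∀ w → Dyck w ⇔ (Σ[ g ∈ ℕ ] walk 0 w ≡ just g)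
dyck⇔walk = flat-prefixes⇔walk 0

dyck-prefix : ∀ r u → Dyck (r ++ u) → Dyck r
dyck-prefix r u dy =
  let (_ , walkH) = to (dyck⇔walk (r ++ u)) dy
      (g , walkg , _) = to (walk-++ 0 r u) walkH
  in from (dyck⇔walk r) (g , walkg)

balanced⇔ : ∀ w {g} → walk 0 w ≡ just g → Balanced w ⇔ g ≡ 0
balanced⇔ w {g} walkg = mk⇔
  (λ bal → +-cancelˡ-≡ (ones w) g 0 (trans (sym (walk-counts w walkg)) (trans bal (sym (+-identityʳ _)))))
  (λ { refl → trans (walk-counts w walkg) (+-identityʳ _) })

module _ {A : Set} where

  take-drop-++ : ∀ n k (r u : List A) → n + k ≤ length r → take k (drop n (r ++ u)) ≡ take k (drop n r)
  take-drop-++ zero zero r u _ = refl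
  take-drop-++ zero (suc k) (x ∷ r) u (s≤s k≤r) = cong (x ∷_) (take-drop-++ zero k r u k≤r)
  take-drop-++ (suc n) k (x ∷ r) u (s≤s n+k≤r) = take-drop-++ n k r u n+k≤r

  take-length-++ : (r u : List A) → take (length r) (r ++ u) ≡ r
  take-length-++ [] u = refl
  take-length-++ (x ∷ r) u = cong (x ∷_) (take-length-++ r u)

  drop-length-++ : (r u : List A) → drop (length r) (r ++ u) ≡ u
  drop-length-++ [] u = refl
  drop-length-++ (x ∷ r) u = drop-length-++ r u

module _ (d : ℕ) where

  -- The conditions a d-straightened word imposes on a block b, where P says
  -- "the letters before b are balanced" and Q "the letters through b are".
  BlockRule : Word → Set → Set → Set
  BlockRule b P Q =
    (((ones b ≡ d) ⊎ (zeros b ≡ d) ⊎ (zeros b ≡ d ∸ 1) ⊎ (ones b ≡ d ∸ 1))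
      × ((zeros b ≡ d ∸ 1 → P) × (ones b ≡ d ∸ 1 → Q)))
    × ((zeros b ≡ d ∸ 1 → last b ≡ just 𝟏) × (ones b ≡ d ∸ 1 → head b ≡ just 𝟎))

  BlockRule-map : ∀ {b} → (P → P′) → (Q → Q′) → BlockRule b P Q → BlockRule b P′ Q′
  BlockRule-map f g ((shape , (type2 , type3)) , straight) = (shape , (f ∘ type2 , g ∘ type3)) , straight

  BlockOK : ℕ → Word → Set
  BlockOK t w = BlockRule (block d t w) (Balanced (before d t w)) (Balanced (throughEnd d t w))

  rule-transport : ∀ {b b′ x x′ y y′} → b ≡ b′ → x ≡ x′ → y ≡ y′ →
                   BlockRule b (Balanced x) (Balanced y) → BlockRule b′ (Balanced x′) (Balanced y′)
  rule-transport refl refl refl rule = rule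

  straightened⇔ : ∀ m w → Straightened d m w ⇔ (length w ≡ m * d × Dyck w × (∀ {t} → t < m → BlockOK t w))
  straightened⇔ m w = mk⇔
    (λ ((len , dy , rules) , straights) →
       len , dy , λ t<m → All.applyUpTo⁻ id m rules t<m , All.applyUpTo⁻ id m straights t<m)
    (λ (len , dy , ok) →
       (len , dy , All.applyUpTo⁺₁ id m (proj₁ ∘ ok)) , All.applyUpTo⁺₁ id m (proj₂ ∘ ok))

  module _ {m} (r u : Word) (len-r : length r ≡ m * d) (len-u : length u ≡ d) where

    earlier-block : ∀ {t} → t < m → BlockOK t (r ++ u) ⇔ BlockOK t r
    earlier-block {t} t<m = mk⇔ (rule-transport block≡ before≡ through≡)
                                (rule-transport (sym block≡) (sym before≡) (sym through≡))
      where
      end≤ : t * d + d ≤ length r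
      end≤ = subst₂ _≤_ (+-comm d (t * d)) (sym len-r) (*-monoˡ-≤ d t<m)
      window : ∀ n k → n + k ≤ t * d + d → take k (drop n (r ++ u)) ≡ take k (drop n r)
      window n k n+k≤ = take-drop-++ n k r u (≤-trans n+k≤ end≤)
      block≡ : block d t (r ++ u) ≡ block d t r
      block≡ = window (t * d) d ≤-refl
      before≡ : before d t (r ++ u) ≡ before d t r
      before≡ = window 0 (t * d) (m≤m+n (t * d) d)
      through≡ : throughEnd d t (r ++ u) ≡ throughEnd d t r
      through≡ = window 0 (t * d + d) ≤-refl

    last-block : BlockOK m (r ++ u) ⇔ BlockRule u (Balanced r) (Balanced (r ++ u))
    last-block = mk⇔ (rule-transport block≡ before≡ through≡)
                     (rule-transport (sym block≡) (sym before≡) (sym through≡))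
      where
      block≡ : block d m (r ++ u) ≡ u
      block≡ = begin
        take d (drop (m * d) (r ++ u))      ≡⟨ cong (λ n → take d (drop n (r ++ u))) (sym len-r) ⟩
        take d (drop (length r) (r ++ u))   ≡⟨ cong (take d) (drop-length-++ r u) ⟩
        take d u                            ≡⟨ take-all d u (≤-reflexive len-u) ⟩
        u                                   ∎
      before≡ : before d m (r ++ u) ≡ r
      before≡ = trans (cong (λ n → take n (r ++ u)) (sym len-r)) (take-length-++ r u)
      through≡ : throughEnd d m (r ++ u) ≡ r ++ u
      through≡ = take-all (m * d + d) (r ++ u)
                   (≤-reflexive (trans (length-++ r) (cong₂ _+_ len-r len-u)))

    straightened-snoc : Straightened d (suc m) (r ++ u) ⇔
                        (Straightened d m r × Dyck (r ++ u) × BlockRule u (Balanced r) (Balanced (r ++ u)))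
    straightened-snoc = mk⇔
      (λ str → let (_ , dy , ok) = to (straightened⇔ (suc m) (r ++ u)) str in
         from (straightened⇔ m r) (len-r , dyck-prefix r u dy , λ t<m → to (earlier-block t<m) (ok (m<n⇒m<1+n t<m)))
         , dy , to last-block (ok (n<1+n m)))
      (λ (str , dy , rule) → let (_ , _ , ok) = to (straightened⇔ m r) str in
         from (straightened⇔ (suc m) (r ++ u)) (len , dy , λ t<1+m → okAt ok rule (m<1+n⇒m<n∨m≡n t<1+m)))
      where
      len : length (r ++ u) ≡ suc m * d
      len = trans (length-++ r) (trans (cong₂ _+_ len-r len-u) (+-comm (m * d) d))
      okAt : (∀ {t} → t < m → BlockOK t r) → BlockRule u (Balanced r) (Balanced (r ++ u)) →
             ∀ {t} → t < m ⊎ t ≡ m → BlockOK t (r ++ u)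
      okAt ok rule (inj₁ t<m) = from (earlier-block t<m) (ok t<m)
      okAt ok rule (inj₂ refl) = from last-block rule

  Reach : ℕ → ℕ → Word → Set
  Reach m H w = Straightened d m w × walk 0 w ≡ just H

  reach? : ∀ m H w → Dec (Reach m H w)
  reach? m H w = straightened? d m w ×-dec Maybe.≡-dec _≟_ (walk 0 w) (just H)

  reachCount : ℕ → ℕ → ℕ
  reachCount m H = total (d * m) (𝟙 ∘ reach? m H)

  Step : ℕ → Word → ℕ → Set
  Step g u H = walk g u ≡ just H × BlockRule u (g ≡ 0) (H ≡ 0)

  -- The last block only interacts with the rest through the height between them.
  reach-snoc : ∀ {m H} r u → length r ≡ m * d → length u ≡ d →
               Reach (suc m) H (r ++ u) ⇔ (Σ[ g ∈ ℕ ] (Reach m g r × Step g u H))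
  reach-snoc {m} {H} r u len-r len-u = mk⇔
    (λ (str , walkH) →
       let (strᵣ , _ , rule) = to (straightened-snoc r u len-r len-u) str
           (g , walkg , stepᵤ) = to (walk-++ 0 r u) walkH
       in g , (strᵣ , walkg) , stepᵤ ,
          BlockRule-map (to (balanced⇔ r walkg)) (to (balanced⇔ (r ++ u) walkH)) rule)
    (λ (g , (strᵣ , walkg) , stepᵤ , rule) →
       let walkH = from (walk-++ 0 r u) (g , walkg , stepᵤ)
       in from (straightened-snoc r u len-r len-u)
            (strᵣ , from (dyck⇔walk (r ++ u)) (H , walkH) ,
             BlockRule-map (from (balanced⇔ r walkg)) (from (balanced⇔ (r ++ u) walkH)) rule) ,
          walkH)

  reach-empty : reachCount 0 0 ≡ 1
  reach-empty = cong (λ n → total n (𝟙 ∘ reach? 0 0)) (*-zeroʳ d)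

  reach-far : ∀ m H → d * m < H → reachCount m H ≡ 0
  reach-far m H dm<H = trans (total-cong (d * m) _ _ (λ w len → 𝟙-no (unreachable w len) (reach? m H w)))
                             (sum-map-zero (allWords (d * m)))
    where
    unreachable : ∀ w → length w ≡ d * m → ¬ Reach m H w
    unreachable w len (_ , walkH) = <⇒≱ dm<H (≤-trans H≤zeros zeros≤dm)
      where
      H≤zeros : H ≤ zeros w
      H≤zeros = subst (H ≤_) (sym (walk-counts w walkH)) (m≤n+m H (ones w))
      zeros≤dm : zeros w ≤ d * m
      zeros≤dm = subst (zeros w ≤_) (trans (zeros+ones w) len) (m≤m+n (zeros w) (ones w))

  countStraight≡reachCount : ∀ m {z o H} → z ≡ o + H → z + o ≡ d * m → countStraight d m z o ≡ reachCount m H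
  countStraight≡reachCount m {z} {o} {H} z≡ z+o≡ =
    trans (length-filter≡sum _ (allWords (d * m)))
          (total-cong (d * m) _ _ (λ w len → 𝟙-cong (same-words w len) _ (reach? m H w)))
    where
    same-words : ∀ w → length w ≡ d * m → (Straightened d m w × zeros w ≡ z × ones w ≡ o) ⇔ Reach m H w
    same-words w len = mk⇔
      (λ (str@((_ , dy , _) , _) , zeros≡ , ones≡) →
         let (g , walkg) = to (dyck⇔walk w) dy
             g≡H = +-cancelˡ-≡ (ones w) g H
                     (begin
                       ones w + g  ≡⟨ walk-counts w walkg ⟨
                       zeros w     ≡⟨ trans zeros≡ z≡ ⟩
                       o + H       ≡⟨ cong (_+ H) ones≡ ⟨
                       ones w + H  ∎)
         in str , subst (λ h → walk 0 w ≡ just h) g≡H walkg)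
      (λ (str , walkH) → str , difference-and-sum (walk-counts w walkH) z≡
                                  (trans (zeros+ones w) (trans len (sym z+o≡))))

  record Entry (H s₁ s₂ : ℕ) : Set where
    field
      b₁ b₂    : Word
      length₁  : length b₁ ≡ d
      length₂  : length b₂ ≡ d
      distinct : b₁ ≢ b₂
      step₁    : Step s₁ b₁ H
      step₂    : Step s₂ b₂ H
      only     : ∀ {g u} → length u ≡ d → Step g u H → (u ≡ b₁ × g ≡ s₁) ⊎ (u ≡ b₂ × g ≡ s₂)

  entering : ∀ {H s₁ s₂} → Entry H s₁ s₂ → ∀ m → reachCount (suc m) H ≡ reachCount m s₁ + reachCount m s₂
  entering {H} {s₁} {s₂} entry m = begin
    total (d * suc m) (𝟙 ∘ reach? (suc m) H)
      ≡⟨ cong (λ n → total n (𝟙 ∘ reach? (suc m) H)) (trans (*-suc d m) (+-comm d (d * m))) ⟩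
    total (d * m + d) (𝟙 ∘ reach? (suc m) H)
      ≡⟨ total-++ (d * m) d (𝟙 ∘ reach? (suc m) H) ⟩
    total (d * m) (λ r → total d (λ u → 𝟙 (reach? (suc m) H (r ++ u))))
      ≡⟨ total-cong (d * m) _ _ (λ r len → count-two d (λ u → reach? (suc m) H (r ++ u))
                                             (reach? m s₁ r) (reach? m s₂ r) distinct length₁ length₂
                                             (last-entry r (trans len (*-comm d m)))) ⟩
    total (d * m) (λ r → 𝟙 (reach? m s₁ r) + 𝟙 (reach? m s₂ r))
      ≡⟨ total-+ (d * m) (𝟙 ∘ reach? m s₁) (𝟙 ∘ reach? m s₂) ⟩
    reachCount m s₁ + reachCount m s₂ ∎
    where
    open Entry entry
    last-entry : ∀ r → length r ≡ m * d → ∀ u → length u ≡ d →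
                 Reach (suc m) H (r ++ u) ⇔ ((u ≡ b₁ × Reach m s₁ r) ⊎ (u ≡ b₂ × Reach m s₂ r))
    last-entry r len-r u len-u = mk⇔
      (λ reach → let (g , reachᵣ , step) = to (reach-snoc r u len-r len-u) reach in
         Sum.map (λ (u≡b₁ , g≡s₁) → u≡b₁ , subst (λ g → Reach m g r) g≡s₁ reachᵣ)
                 (λ (u≡b₂ , g≡s₂) → u≡b₂ , subst (λ g → Reach m g r) g≡s₂ reachᵣ)
                 (only len-u step))
      (λ { (inj₁ (refl , reachᵣ)) → from (reach-snoc r u len-r len-u) (s₁ , reachᵣ , step₁)
         ; (inj₂ (refl , reachᵣ)) → from (reach-snoc r u len-r len-u) (s₂ , reachᵣ , step₂) })

module BlockLength (e : ℕ) where

  d : ℕ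
  d = suc (suc e)

  zerosBlock onesBlock type2Block type3Block : Word
  zerosBlock = replicate d 𝟎
  onesBlock  = replicate d 𝟏
  type2Block = replicate (suc e) 𝟎 ++ 𝟏 ∷ []
  type3Block = 𝟎 ∷ replicate (suc e) 𝟏

  type2≡type3 : e ≡ 0 → type2Block ≡ type3Block
  type2≡type3 refl = refl

  zeros-type2 : zeros type2Block ≡ suc e
  zeros-type2 = trans (occ-++ 𝟎 (replicate (suc e) 𝟎) (𝟏 ∷ [])) (trans (+-identityʳ _) (occ-replicate 𝟎 (suc e)))

  ones-type2 : ones type2Block ≡ 1
  ones-type2 = trans (occ-++ 𝟏 (replicate (suc e) 𝟎) (𝟏 ∷ [])) (cong (_+ 1) (occ-replicate-other 𝟏 𝟎 (λ ()) (suc e)))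

  d≢1+e : d ≢ suc e
  d≢1+e = 1+n≢n

  plain-rule : ∀ b → (ones b ≡ d) ⊎ (zeros b ≡ d) → zeros b ≢ suc e → ones b ≢ suc e → BlockRule d b P Q
  plain-rule b shape ¬type2 ¬type3 =
    (Sum.map₂ inj₁ shape , (λ t → contradiction t ¬type2) , (λ t → contradiction t ¬type3))
    , (λ t → contradiction t ¬type2) , (λ t → contradiction t ¬type3)

  zeros-step : ∀ g → Step d g zerosBlock (d + g)
  zeros-step g = walk-zeros d g , plain-rule zerosBlock (inj₂ zeros≡d) (d≢1+e ∘ trans (sym zeros≡d)) (0≢1+n ∘ trans (sym ones≡0))
    where
    zeros≡d : zeros zerosBlock ≡ d
    zeros≡d = occ-replicate 𝟎 d
    ones≡0 : ones zerosBlock ≡ 0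
    ones≡0 = occ-replicate-other 𝟏 𝟎 (λ ()) d

  ones-step : ∀ H → Step d (d + H) onesBlock H
  ones-step H = walk-ones d H , plain-rule onesBlock (inj₁ ones≡d) (0≢1+n ∘ trans (sym zeros≡0)) (d≢1+e ∘ trans (sym ones≡d))
    where
    ones≡d : ones onesBlock ≡ d
    ones≡d = occ-replicate 𝟏 d
    zeros≡0 : zeros onesBlock ≡ 0
    zeros≡0 = occ-replicate-other 𝟎 𝟏 (λ ()) d

  type2-step : Step d 0 type2Block e
  type2-step = walk≡ , ((inj₂ (inj₂ (inj₁ zeros-type2)) , (λ _ → refl) , e≡0) , (λ _ → last-snoc (replicate (suc e) 𝟎) 𝟏) , (λ _ → refl))
    where
    walk≡ : walk 0 type2Block ≡ just e
    walk≡ = from (walk-++ 0 (replicate (suc e) 𝟎) (𝟏 ∷ [])) (suc e + 0 , walk-zeros (suc e) 0 , cong just (+-identityʳ e))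
    e≡0 : ones type2Block ≡ suc e → e ≡ 0
    e≡0 ones≡ = sym (suc-injective (trans (sym ones-type2) ones≡))

  type3-step : Step d e type3Block 0
  type3-step = walk≡ , ((inj₂ (inj₂ (inj₂ ones≡))) , e≡0 , (λ _ → refl)) , (λ _ → last-replicate 𝟎 𝟏 e) , (λ _ → refl)
    where
    walk≡ : walk e type3Block ≡ just 0
    walk≡ = subst (λ h → walk h (replicate (suc e) 𝟏) ≡ just 0) (+-identityʳ (suc e)) (walk-ones (suc e) 0)
    ones≡ : ones type3Block ≡ suc e
    ones≡ = occ-replicate 𝟏 (suc e)
    e≡0 : zeros type3Block ≡ suc e → e ≡ 0
    e≡0 zeros≡ = sym (suc-injective (trans (sym (cong suc (occ-replicate-other 𝟎 𝟏 (λ ()) (suc e)))) zeros≡))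

  Transition : ℕ → Word → ℕ → Set
  Transition g u H = (u ≡ zerosBlock × H ≡ d + g) ⊎ (u ≡ onesBlock × g ≡ d + H)
                     ⊎ (u ≡ type2Block × g ≡ 0 × H ≡ e) ⊎ (u ≡ type3Block × g ≡ e × H ≡ 0)

  type3-shape : ∀ u → length u ≡ d → ones u ≡ suc e → head u ≡ just 𝟎 → u ≡ type3Block
  type3-shape (𝟎 ∷ u) len ones≡ _ = cong (𝟎 ∷_) (trans (no-zeros u zeros≡0) (cong (λ n → replicate n 𝟏) len′))
    where
    len′ : length u ≡ suc e
    len′ = suc-injective len
    zeros≡0 : zeros u ≡ 0
    zeros≡0 = +-cancelʳ-≡ (suc e) (zeros u) 0 (trans (cong (zeros u +_) (sym ones≡)) (trans (zeros+ones u) len′))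

  step-cases : ∀ {g u H} → length u ≡ d → Step d g u H → Transition g u H
  step-cases {g} {u} {H} len (walkH , (shape , type2 , type3) , ends-with-1 , starts-with-0) = classify shape
    where
    counts : g + zeros u ≡ ones u + H
    counts = walk-counts u walkH
    letters : zeros u + ones u ≡ d
    letters = trans (zeros+ones u) len
    classify : (ones u ≡ d) ⊎ (zeros u ≡ d) ⊎ (zeros u ≡ suc e) ⊎ (ones u ≡ suc e) → Transition g u H
    classify (inj₁ ones≡d) = inj₂ (inj₁ (u≡ , trans (sym (+-identityʳ g)) (subst₂ (λ z o → g + z ≡ o + H) zeros≡0 ones≡d counts)))
      where
      zeros≡0 : zeros u ≡ 0
      zeros≡0 = +-cancelʳ-≡ d (zeros u) 0 (trans (cong (zeros u +_) (sym ones≡d)) letters)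
      u≡ : u ≡ onesBlock
      u≡ = trans (no-zeros u zeros≡0) (cong (λ n → replicate n 𝟏) len)
    classify (inj₂ (inj₁ zeros≡d)) = inj₁ (u≡ , trans (sym (subst₂ (λ z o → g + z ≡ o + H) zeros≡d ones≡0 counts)) (+-comm g d))
      where
      ones≡0 : ones u ≡ 0
      ones≡0 = +-cancelˡ-≡ d (ones u) 0 (trans (cong (_+ ones u) (sym zeros≡d)) (trans letters (sym (+-identityʳ d))))
      u≡ : u ≡ zerosBlock
      u≡ = trans (no-ones u ones≡0) (cong (λ n → replicate n 𝟎) len)
    classify (inj₂ (inj₂ (inj₁ zeros≡))) =
      inj₂ (inj₂ (inj₁ (u≡ , g≡0 , H≡e)))
      where
      g≡0 : g ≡ 0
      g≡0 = type2 zeros≡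
      ones≡1 : ones u ≡ 1
      ones≡1 = +-cancelˡ-≡ (suc e) (ones u) 1 (trans (cong (_+ ones u) (sym zeros≡)) (trans letters (+-comm 1 (suc e))))
      u≡ : u ≡ type2Block
      u≡ = trans (single-final-one u ones≡1 (ends-with-1 zeros≡)) (cong (λ n → replicate n 𝟎 ++ 𝟏 ∷ []) zeros≡)
      H≡e : H ≡ e
      H≡e = sym (suc-injective (subst₂ (λ z o → z ≡ o + H) zeros≡ ones≡1
                                  (subst (λ g → g + zeros u ≡ ones u + H) g≡0 counts)))
    classify (inj₂ (inj₂ (inj₂ ones≡))) =
      inj₂ (inj₂ (inj₂ (type3-shape u len ones≡ (starts-with-0 ones≡) , g≡e , H≡0)))
      where
      H≡0 : H ≡ 0
      H≡0 = type3 ones≡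
      zeros≡1 : zeros u ≡ 1
      zeros≡1 = +-cancelʳ-≡ (suc e) (zeros u) 1 (trans (cong (zeros u +_) (sym ones≡)) letters)
      g≡e : g ≡ e
      g≡e = +-cancelʳ-≡ 1 g e (trans (subst₂ (λ z o → g + z ≡ o + H) zeros≡1 ones≡ counts)
                                     (trans (cong (suc e +_) H≡0) (trans (+-identityʳ (suc e)) (+-comm 1 e))))

  -- The height of the integer state u - v: state n ≥ 0 sits at n·d and
  -- state -(n+1) at n·d + e.
  level : ℕ → ℕ → ℕ
  level u zero = u * d
  level zero (suc v) = v * d + e
  level (suc u) (suc v) = level u v

  e<d+ : ∀ x → e < d + x
  e<d+ x = s≤s (≤-trans (n≤1+n e) (m≤m+n (suc e) x))

  length-type3 : length type3Block ≡ d
  length-type3 = cong suc (length-replicate (suc e))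

  entry-origin : Entry d (level 0 0) (level 0 1) (level 1 0)
  entry-origin = record
    { b₁ = type3Block ; b₂ = onesBlock ; length₁ = length-type3 ; length₂ = length-replicate d
    ; distinct = λ () ; step₁ = type3-step ; step₂ = ones-step 0 ; only = λ len → sources ∘ step-cases len }
    where
    sources : ∀ {g u} → Transition g u 0 → (u ≡ type3Block × g ≡ e) ⊎ (u ≡ onesBlock × g ≡ d + 0)
    sources (inj₁ (_ , ()))
    sources (inj₂ (inj₁ from-above)) = inj₂ from-above
    sources (inj₂ (inj₂ (inj₁ (u≡ , g≡0 , 0≡e)))) = inj₁ (trans u≡ (type2≡type3 (sym 0≡e)) , trans g≡0 0≡e)
    sources (inj₂ (inj₂ (inj₂ (u≡ , g≡e , _)))) = inj₁ (u≡ , g≡e)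

  entry-minus-one : Entry d (level 0 1) (level 0 2) (level 1 1)
  entry-minus-one = record
    { b₁ = onesBlock ; b₂ = type2Block ; length₁ = length-replicate d
    ; length₂ = trans (length-++ (replicate (suc e) 𝟎)) (trans (cong (_+ 1) (length-replicate (suc e))) (+-comm (suc e) 1))
    ; distinct = λ () ; step₁ = subst (λ g → Step d g onesBlock e) d+e≡ (ones-step e) ; step₂ = type2-step
    ; only = λ len → sources ∘ step-cases len }
    where
    d+e≡ : d + e ≡ (d + 0) + e
    d+e≡ = cong (_+ e) (sym (+-identityʳ d))
    sources : ∀ {g u} → Transition g u e → (u ≡ onesBlock × g ≡ (d + 0) + e) ⊎ (u ≡ type2Block × g ≡ 0)
    sources (inj₁ (_ , e≡d+g)) = contradiction e≡d+g (<⇒≢ (e<d+ _))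
    sources (inj₂ (inj₁ (u≡ , g≡))) = inj₁ (u≡ , trans g≡ d+e≡)
    sources (inj₂ (inj₂ (inj₁ (u≡ , g≡0 , _)))) = inj₂ (u≡ , g≡0)
    sources (inj₂ (inj₂ (inj₂ (u≡ , g≡e , e≡0)))) = inj₂ (trans u≡ (sym (type2≡type3 e≡0)) , trans g≡e e≡0)

  entry-positive : ∀ n → Entry d (level (suc n) 0) (level (suc n) 1) (level (suc (suc n)) 0)
  entry-positive n = record
    { b₁ = zerosBlock ; b₂ = onesBlock ; length₁ = length-replicate d ; length₂ = length-replicate d
    ; distinct = λ () ; step₁ = zeros-step (n * d) ; step₂ = ones-step (d + n * d)
    ; only = λ len → sources ∘ step-cases len }
    where
    sources : ∀ {g u} → Transition g u (d + n * d) → (u ≡ zerosBlock × g ≡ n * d) ⊎ (u ≡ onesBlock × g ≡ d + (d + n * d))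
    sources (inj₁ (u≡ , H≡)) = inj₁ (u≡ , sym (+-cancelˡ-≡ d (n * d) _ H≡))
    sources (inj₂ (inj₁ from-above)) = inj₂ from-above
    sources (inj₂ (inj₂ (inj₁ (_ , _ , H≡e)))) = contradiction (sym H≡e) (<⇒≢ (e<d+ (n * d)))
    sources (inj₂ (inj₂ (inj₂ (_ , _ , ()))))

  entry-negative : ∀ n → Entry d (level 0 (suc (suc n))) (level 0 (suc (suc (suc n)))) (level 1 (suc (suc n)))
  entry-negative n = record
    { b₁ = onesBlock ; b₂ = zerosBlock ; length₁ = length-replicate d ; length₂ = length-replicate d
    ; distinct = λ ()
    ; step₁ = subst (λ g → Step d g onesBlock H) (sym (+-assoc d (d + n * d) e)) (ones-step H)
    ; step₂ = subst (Step d (n * d + e) zerosBlock) (sym (+-assoc d (n * d) e)) (zeros-step (n * d + e))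
    ; only = λ len → sources ∘ step-cases len }
    where
    H = (d + n * d) + e
    sources : ∀ {g u} → Transition g u H → (u ≡ onesBlock × g ≡ (d + (d + n * d)) + e) ⊎ (u ≡ zerosBlock × g ≡ n * d + e)
    sources (inj₁ (u≡ , H≡)) = inj₂ (u≡ , sym (+-cancelˡ-≡ d (n * d + e) _ (trans (sym (+-assoc d (n * d) e)) H≡)))
    sources (inj₂ (inj₁ (u≡ , g≡))) = inj₁ (u≡ , trans g≡ (sym (+-assoc d (d + n * d) e)))
    sources (inj₂ (inj₂ (inj₁ (_ , _ , H≡e)))) = contradiction (sym H≡e) (<⇒≢ (m<n+m e z<s))
    sources (inj₂ (inj₂ (inj₂ (_ , _ , ()))))

  reach-step : ∀ m u v → reachCount d (suc m) (level u v) ≡ reachCount d m (level u (suc v)) + reachCount d m (level (suc u) v)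
  reach-step m zero zero = entering d entry-origin m
  reach-step m (suc n) zero = entering d (entry-positive n) m
  reach-step m zero (suc zero) = entering d entry-minus-one m
  reach-step m zero (suc (suc n)) = entering d (entry-negative n) m
  reach-step m (suc u) (suc v) = reach-step m u v

  d*m<[1+m]*d : ∀ m → d * m < suc m * d
  d*m<[1+m]*d m = subst (_< suc m * d) (*-comm m d) (m<n+m (m * d) z<s)

  -- Only the all-zero word reaches the top state.
  reach-top : ∀ u → reachCount d u (level u 0) ≡ 1
  reach-top zero = reach-empty d
  reach-top (suc u) = begin
    reachCount d (suc u) (level (suc u) 0)                            ≡⟨ reach-step u (suc u) 0 ⟩
    reachCount d u (level u 0) + reachCount d u (level (suc (suc u)) 0) ≡⟨ cong₂ _+_ (reach-top u) (reach-far d u _ far) ⟩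
    1                                                                 ∎
    where
    far : d * u < suc (suc u) * d
    far = <-≤-trans (d*m<[1+m]*d u) (m≤n+m (suc u * d) d)

  -- Only the word (0…01)(0…0)⋯(0…0) reaches the bottom state.
  reach-bottom : ∀ v → reachCount d v (level 0 v) ≡ 1
  reach-bottom zero = reach-empty d
  reach-bottom (suc v) = begin
    reachCount d (suc v) (level 0 (suc v))                             ≡⟨ reach-step v 0 (suc v) ⟩
    reachCount d v (level 0 (suc (suc v))) + reachCount d v (level 0 v) ≡⟨ cong₂ _+_ (reach-far d v _ far) (reach-bottom v) ⟩
    1                                                                  ∎
    where
    far : d * v < suc v * d + e
    far = <-≤-trans (d*m<[1+m]*d v) (m≤m+n (suc v * d) e)

  reach-binomial : ∀ u v → reachCount d (u + v) (level u v) ≡ (u + v) C v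
  reach-binomial zero v = trans (reach-bottom v) (sym (nCn≡1 v))
  reach-binomial (suc u) zero = trans (cong (λ m → reachCount d m (level (suc u) 0)) (+-identityʳ (suc u))) (reach-top (suc u))
  reach-binomial (suc u) (suc v) = begin
    reachCount d (suc (u + suc v)) (level u v)
      ≡⟨ reach-step (u + suc v) u v ⟩
    reachCount d (u + suc v) (level u (suc v)) + reachCount d (u + suc v) (level (suc u) v)
      ≡⟨ cong₂ _+_ (reach-binomial u (suc v)) (trans (cong (λ m → reachCount d m (level (suc u) v)) (+-suc u v))
                                                     (reach-binomial (suc u) v)) ⟩
    (u + suc v) C suc v + (suc u + v) C v
      ≡⟨ cong (λ n → (u + suc v) C suc v + n C v) (+-suc u v) ⟨
    (u + suc v) C suc v + (u + suc v) C v
      ≡⟨ +-comm ((u + suc v) C suc v) _ ⟩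
    (u + suc v) C v + (u + suc v) C suc v
      ≡⟨ nCk+nC[k+1]≡[n+1]C[k+1] (u + suc v) v ⟩
    suc (u + suc v) C suc v ∎

  level-above : ∀ {j k} → k ≤ j → d * k + level j k ≡ d * j
  level-above {j} {zero} z≤n = trans (cong (_+ j * d) (*-zeroʳ d)) (*-comm j d)
  level-above {suc j} {suc k} (s≤s k≤j) = begin
    d * suc k + level j k    ≡⟨ cong (_+ level j k) (*-suc d k) ⟩
    d + d * k + level j k    ≡⟨ +-assoc d (d * k) (level j k) ⟩
    d + (d * k + level j k)  ≡⟨ cong (d +_) (level-above k≤j) ⟩
    d + d * j                ≡⟨ *-suc d j ⟨
    d * suc j                ∎

  level-below : ∀ {j k} → j < k → d * j + 1 + level j k + 1 ≡ d * k
  level-below {zero} {suc k} _ = base e k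
    where
    base : ∀ e k → suc (suc e) * 0 + 1 + (k * suc (suc e) + e) + 1 ≡ suc (suc e) * suc k
    base = solve-∀
  level-below {suc j} {suc k} (s≤s j<k) = begin
    d * suc j + 1 + level j k + 1      ≡⟨ shift d j (level j k) ⟩
    d + (d * j + 1 + level j k + 1)    ≡⟨ cong (d +_) (level-below j<k) ⟩
    d + d * k                          ≡⟨ *-suc d k ⟨
    d * suc k                          ∎
    where
    shift : ∀ d j l → d * suc j + 1 + l + 1 ≡ d + (d * j + 1 + l + 1)
    shift = solve-∀

  -- The theorem for j ≥ k: dj zeros and dk ones means ending in state j - k.
  T-above : ∀ {j k} → k ≤ j → countStraight d (j + k) (d * j) (d * k) ≡ (j + k) C k
  T-above {j} {k} k≤j = trans (countStraight≡reachCount d (j + k) (sym (level-above k≤j)) (sym (*-distribˡ-+ d j k)))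
                              (reach-binomial j k)

  -- The theorem for j < k: dk - 1 zeros and dj + 1 ones means ending in state j - k.
  T-below : ∀ {j k} → j < k → countStraight d (j + k) (d * k ∸ 1) (d * j + 1) ≡ (j + k) C k
  T-below {j} {k} j<k = trans (countStraight≡reachCount d (j + k) zeros≡ sum≡) (reach-binomial j k)
    where
    zeros≡ : d * k ∸ 1 ≡ d * j + 1 + level j k
    zeros≡ = trans (cong (_∸ 1) (sym (level-below j<k))) (m+n∸n≡m _ 1)
    rearrange : ∀ a l → a + 1 + l + (a + 1) ≡ a + (a + 1 + l + 1)
    rearrange = solve-∀
    sum≡ : d * k ∸ 1 + (d * j + 1) ≡ d * (j + k)
    sum≡ = begin
      d * k ∸ 1 + (d * j + 1)               ≡⟨ cong (_+ (d * j + 1)) zeros≡ ⟩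
      d * j + 1 + level j k + (d * j + 1)   ≡⟨ rearrange (d * j) (level j k) ⟩
      d * j + (d * j + 1 + level j k + 1)   ≡⟨ cong (d * j +_) (level-below j<k) ⟩
      d * j + d * k                         ≡⟨ *-distribˡ-+ d j k ⟨
      d * (j + k)                           ∎

lemma5p12 : (d j k : ℕ) → 1 < d → T d j k ≡ (j + k) C k
lemma5p12 (suc zero) j k (s≤s ())
lemma5p12 (suc (suc e)) j k _ with k ≤? j
... | yes k≤j = BlockLength.T-above e k≤j
... | no k≰j  = BlockLength.T-below e (≰⇒> k≰j)
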